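{- Let $t,s,c,\sigma,\gamma$ be positive integers with $\gamma<c$, and let $r=r(t,s,c,\sigma,\gamma)$ be the optimal (minimum) number of dinners of the Business Dinner Problem with these parameters. Then $r\geq lb_i$ for each $i=1,\ldots,5$, where $$lb_1=\left\lceil\frac{s}{\sigma}\right\rceil,\quad lb_2=\left\lceil\frac{c}{\gamma}\right\rceil,\quad lb_3=\left\lceil\frac{s}{t\sigma}\left\lceil\frac{c}{\gamma}\right\rceil\right\rceil,$$ $$lb_4=\left\lceil\frac{\sqrt{s}}{t\gamma}\left((c-\gamma)\max\left(\sqrt{\frac{\gamma}{c-\gamma}},1\right)+\frac{\gamma}{\max\left(\sqrt{\frac{\gamma}{c-\gamma}},1\right)}\right)\right\rceil,$$ $$lb_5=\max_{j\in\{2,\ldots,\sigma\}}\left\lceil\frac{s}{t} \left(\frac 2 {j} \left\lceil\frac{c}{\gamma}\right\rceil-\frac{s-1}{j(j-1)}\right)\right\rceil.$$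
   Context: Business Dinner Problem: given positive integers $t$ (number of tables), $s$ (suppliers $S=\{1,\ldots,s\}$), $c$ (customers $C=\{1,\ldots,c\}$), $\sigma$ and $\gamma$. A schedule is a finite sequence of dinners; in each dinner, each participant (supplier or customer) sits at at most one of the $t$ tables (participants may be absent from a dinner), and each table hosts at most $\sigma$ suppliers and at most $\gamma$ customers. The schedule is feasible if (i) any two distinct suppliers sit at the same table in at most one dinner, and (ii) every customer and every supplier sit at the same table in exactly one dinner. The optimal value $r(t,s,c,\sigma,\gamma)$ is the minimum number of dinners of a feasible schedule. -}

module Defs where

open import Data.Nat as ℕ using (ℕ; zero; suc; _+_; _*_; _∸_; _≤_; _<_; NonZero)
open import Data.Fin using (Fin; _≟_)
open import Data.Maybe using (Maybe; just; nothing)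
open import Data.Maybe.Properties using (≡-dec)
open import Data.List using (List; length; filter)
open import Data.List.Base renaming (allFin to allFinL) using ()
open import Relation.Nullary using (¬_; yes; no)
open import Data.Product using (Σ; _×_; ∃)
open import Relation.Binary.PropositionalEquality using (_≡_)
open import Data.Integer as ℤ using (ℤ; +_)
open import Data.Rational as ℚ using (ℚ; _/_; ceiling)

-- In dinner d, supplier x sits at table k iff  supSeat d x ≡ just k,
-- and is absent iff supSeat d x ≡ nothing (similarly for customers).
record Schedule (n t s c : ℕ) : Set where
  field
    supSeat : Fin n → Fin s → Maybe (Fin t)
    cusSeat : Fin n → Fin c → Maybe (Fin t)

numAt : ∀ {m t} → (Fin m → Maybe (Fin t)) → Fin t → ℕ
numAt {m} f k = length (filter (λ x → ≡-dec _≟_ (f x) (just k)) (allFinL m))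

module _ {n t s c : ℕ} (S : Schedule n t s c) where
  open Schedule S

  SSmeet : Fin n → Fin s → Fin s → Set
  SSmeet d x y = Σ (Fin t) λ k → (supSeat d x ≡ just k) × (supSeat d y ≡ just k)

  SCmeet : Fin n → Fin s → Fin c → Set
  SCmeet d x y = Σ (Fin t) λ k → (supSeat d x ≡ just k) × (cusSeat d y ≡ just k)

record Feasible {n t s c : ℕ} (σ γ : ℕ) (S : Schedule n t s c) : Set where
  open Schedule S
  field
    capS : ∀ (d : Fin n) (k : Fin t) → numAt (supSeat d) k ≤ σ
    capC : ∀ (d : Fin n) (k : Fin t) → numAt (cusSeat d) k ≤ γ
    atMostOnce : ∀ (x y : Fin s) → ¬ (x ≡ y) → ∀ (d d' : Fin n) →
                 SSmeet S d x y → SSmeet S d' x y → d ≡ d'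
    meetOnce : ∀ (x : Fin s) (y : Fin c) → ∃ λ d → SCmeet S d x y
    meetUnique : ∀ (x : Fin s) (y : Fin c) (d d' : Fin n) →
                 SCmeet S d x y → SCmeet S d' x y → d ≡ d'

IsOptimal : (t s c σ γ r : ℕ) → Set
IsOptimal t s c σ γ r =
  (Σ (Schedule r t s c) λ S → Feasible σ γ S) ×
  (∀ (n : ℕ) (S : Schedule n t s c) → Feasible σ γ S → r ≤ n)

⌈_÷_⌉ : (a b : ℕ) → .{{NonZero b}} → ℤ
⌈ a ÷ b ⌉ = ceiling ((+ a) / b)

-- Lower bound lb4 condition.  lb4 = ⌈ x ⌉ with
--   x = √s/(tγ) · ((c-γ)·m + γ/m),  m = max(√(γ/(c-γ)), 1).
-- Since r is an integer, r ≥ ⌈x⌉ ⇔ r ≥ x ⇔ r·t·γ ≥ √s·((c-γ)m + γ/m).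
-- If γ ≥ c-γ then m = √(γ/(c-γ)) and (c-γ)m + γ/m = 2√(γ(c-γ)),
--   so the condition is (r t γ)² ≥ 4 s γ (c-γ).
-- If γ < c-γ then m = 1 and (c-γ)m + γ/m = c,
--   so the condition is (r t γ)² ≥ s c².
-- (Both sides are nonnegative, so squaring is an equivalence.)
Lb4≤ : (t s c γ r : ℕ) → Set
Lb4≤ t s c γ r with γ ℕ.<? (c ∸ γ)
... | yes _ = s * (c * c) ≤ (r * t * γ) * (r * t * γ)
... | no _  = 4 * s * γ * (c ∸ γ) ≤ (r * t * γ) * (r * t * γ)

-- Double counting on a feasible schedule with r dinners.  A supplier meets all c customers, at
-- most γ per dinner it attends, so every supplier attends at least ⌈c/γ⌉ dinners; symmetrically
-- every customer attends at least ⌈s/σ⌉, and comparing the total supplier attendance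
-- A ≥ s⌈c/γ⌉ with the tσ seats per dinner gives lb₃.  For lb₅, let a range over the numbers of
-- suppliers at the tables of all dinners: Σ a² counts ordered pairs of suppliers sitting
-- together, so Σ a² ≤ s(s-1) + A because distinct suppliers sit together at most once, and
-- summing (2p+1)a ≤ a² + p(p+1) over the r t tables gives 2pA ≤ s(s-1) + r t p(p+1).
-- For lb₄, take a customer y₀ attending the fewest dinners, n₀ of them, and the dinner where y₀
-- meets the most suppliers, a of them, so that s ≤ a n₀.  These a suppliers have already sat
-- together, so a customer not at y₀'s table that evening meets them at a distinct dinners; hence
-- all but γ customers attend at least max(n₀, a) dinners, γ n₀ + (c-γ) max(n₀, a) ≤ r t γ, and
-- Lb4≤ follows from AM-GM type estimates.
module Submission where

open import Defs
open import Data.Nat as ℕ using (ℕ; suc; _*_; _∸_; _≤_; _<_; NonZero)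
open import Data.Integer as ℤ using (+_)
open import Data.Rational as ℚ using (ℚ; _/_; ceiling)
open import Data.Product using (_×_)
open import Data.Nat.Properties using (m*n≢0)

open import Data.Bool using (if_then_else_)
open import Data.Empty using (⊥-elim)
open import Data.Fin as Fin using (Fin; zero; suc)
open import Data.Fin.Properties as Fin using (_≟_)
open import Data.Integer using (ℤ)
open import Data.Integer.DivMod using (div-pos-is-/ℕ; n<s[n/ℕd]*d)
import Data.Integer.Properties as ℤ
import Data.Integer.Tactic.RingSolver as ℤ-Solver
open import Data.List using (length; filter; tabulate; allFin)
open import Data.List.Extrema.Nat using (argmin; argmax; f[argmin]≤f[xs]; f[xs]≤f[argmax])
open import Data.List.Membership.Propositional.Properties using (∈-allFin)
import Data.List.Relation.Unary.All as All
open import Data.Maybe using (Maybe; just; nothing)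
open import Data.Maybe.Properties using (≡-dec; just-injective)
open import Data.Nat as ℕ using (zero; _+_; _⊔_; z≤n; s≤s)
open import Data.Nat.Properties hiding (_≟_)
open import Algebra.Properties.Semiring.Sum +-*-semiring
  using (sum; sum-syntax; sum-cong-≗; sum-remove; ∑-distrib-+; ∑-comm; *-distribˡ-sum; *-distribʳ-sum)
open import Data.Nat.Tactic.RingSolver using (solve-∀)
open import Data.Product using (Σ; _,_; ∃; proj₁; proj₂)
import Data.Product as Product
open import Data.Rational as ℚ using (mkℚ; ↥_; ↧_; floor; toℚᵘ)
open import Data.Rational.Properties
  using (↥-neg; ↧-neg; toℚᵘ-fromℚᵘ; toℚᵘ-homo-*; toℚᵘ-homo-+; toℚᵘ-homo‿-)
open import Data.Rational.Unnormalised as ℚᵘ using (ℚᵘ; mkℚᵘ; *≤*; _≃_)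
import Data.Rational.Unnormalised.Properties as ℚᵘ
open import Data.Sum using (inj₁; inj₂)
open import Function using (_∘_; id; case_of_)
open import Relation.Nullary using (Dec; does; yes; no; ¬_)
open import Relation.Binary.PropositionalEquality

-- Defined through `does` so that δ (suc i) (suc j) reduces to δ i j.
𝟙 : ∀ {p} {P : Set p} → Dec P → ℕ
𝟙 P? = if does P? then 1 else 0

𝟙≤1 : ∀ {p} {P : Set p} (P? : Dec P) → 𝟙 P? ≤ 1
𝟙≤1 (yes _) = ≤-refl
𝟙≤1 (no _)  = z≤n

𝟙-yes : ∀ {p} {P : Set p} (P? : Dec P) → P → 𝟙 P? ≡ 1
𝟙-yes (yes _) _ = refl
𝟙-yes (no ¬p) p = ⊥-elim (¬p p)

𝟙-no : ∀ {p} {P : Set p} (P? : Dec P) → ¬ P → 𝟙 P? ≡ 0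
𝟙-no (yes p) ¬p = ⊥-elim (¬p p)
𝟙-no (no _)  _  = refl

𝟙*𝟙≤1 : ∀ {p q} {P : Set p} {Q : Set q} (P? : Dec P) (Q? : Dec Q) → 𝟙 P? * 𝟙 Q? ≤ 1
𝟙*𝟙≤1 P? Q? = *-mono-≤ (𝟙≤1 P?) (𝟙≤1 Q?)

𝟙*𝟙-witness : ∀ {p q} {P : Set p} {Q : Set q} (P? : Dec P) (Q? : Dec Q) →
              0 < 𝟙 P? * 𝟙 Q? → P × Q
𝟙*𝟙-witness (yes p) (yes q) _ = p , q

δ : ∀ {n} → Fin n → Fin n → ℕ
δ i j = 𝟙 (i ≟ j)

∑-mono-≤ : ∀ {n} {f g : Fin n → ℕ} → (∀ i → f i ≤ g i) → sum f ≤ sum g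
∑-mono-≤ {zero}  f≤g = z≤n
∑-mono-≤ {suc n} f≤g = +-mono-≤ (f≤g zero) (∑-mono-≤ (f≤g ∘ suc))

∑-const : ∀ n a → ∑[ i < n ] a ≡ n * a
∑-const zero    a = refl
∑-const (suc n) a = cong (_+_ a) (∑-const n a)

∑-zero : ∀ n → ∑[ i < n ] 0 ≡ 0
∑-zero n = trans (∑-const n 0) (*-zeroʳ n)

∑-≤-const : ∀ {n} {f : Fin n → ℕ} {a} → (∀ i → f i ≤ a) → sum f ≤ n * a
∑-≤-const {n} {a = a} f≤a = ≤-trans (∑-mono-≤ f≤a) (≤-reflexive (∑-const n a))

∑-≥-const : ∀ {n} {f : Fin n → ℕ} {a} → (∀ i → a ≤ f i) → n * a ≤ sum f
∑-≥-const {n} {a = a} a≤f = ≤-trans (≤-reflexive (sym (∑-const n a))) (∑-mono-≤ a≤f)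

∑-≤1 : ∀ {n} (f : Fin n → ℕ) → (∀ i → f i ≤ 1) →
       (∀ i j → 0 < f i → 0 < f j → i ≡ j) → sum f ≤ 1
∑-≤1 {zero}  f f≤1 unique = z≤n
∑-≤1 {suc n} f f≤1 unique with f zero ℕ.≟ 0
... | yes f₀≡0 = begin
  f zero + ∑[ i < n ] f (suc i) ≡⟨ cong (_+ ∑[ i < n ] f (suc i)) f₀≡0 ⟩
  ∑[ i < n ] f (suc i)          ≤⟨ ∑-≤1 (f ∘ suc) (f≤1 ∘ suc)
                                     (λ i j p q → Fin.suc-injective (unique (suc i) (suc j) p q)) ⟩
  1                             ∎
  where open ≤-Reasoning
... | no f₀≢0 = begin
  f zero + ∑[ i < n ] f (suc i) ≡⟨ cong (_+_ (f zero)) (trans (sum-cong-≗ rest-zero) (∑-zero n)) ⟩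
  f zero + 0                    ≡⟨ +-identityʳ (f zero) ⟩
  f zero                        ≤⟨ f≤1 zero ⟩
  1                             ∎
  where
  open ≤-Reasoning
  rest-zero : ∀ i → f (suc i) ≡ 0
  rest-zero i = n≤0⇒n≡0 (≮⇒≥ λ p → Fin.0≢1+n (unique zero (suc i) (n≢0⇒n>0 f₀≢0) p))

f≤∑ : ∀ {m} (f : Fin m → ℕ) i → f i ≤ sum f
f≤∑ {suc m} f i = ≤-trans (m≤m+n (f i) _) (≤-reflexive (sym (sum-remove {i = i} f)))

∑-≤-except : ∀ {m} (f : Fin m → ℕ) (x : Fin m) {a b} → f x ≤ a → (∀ y → y ≢ x → f y ≤ b) →
             sum f ≤ a + (m ∸ 1) * b
∑-≤-except {suc m} f x fx≤a fy≤b = begin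
  sum f                                 ≡⟨ sum-remove {i = x} f ⟩
  f x + ∑[ i < m ] f (Fin.punchIn x i)  ≤⟨ +-mono-≤ fx≤a (∑-≤-const λ i → fy≤b _ (Fin.punchInᵢ≢i x i)) ⟩
  _ + m * _                             ∎
  where open ≤-Reasoning

∑-pos⇒∃ : ∀ {n} (f : Fin n → ℕ) → 0 < sum f → ∃ λ i → 0 < f i
∑-pos⇒∃ {suc n} f ∑f>0 with f zero ℕ.≟ 0
... | no  f₀≢0 = zero , n≢0⇒n>0 f₀≢0
... | yes f₀≡0 =
  Product.map suc id (∑-pos⇒∃ (f ∘ suc) (subst (λ a → 0 < a + ∑[ i < n ] f (suc i)) f₀≡0 ∑f>0))

∑*∑ : ∀ {m n} (f : Fin m → ℕ) (g : Fin n → ℕ) → sum f * sum g ≡ ∑[ i < m ] ∑[ j < n ] (f i * g j)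
∑*∑ f g = trans (*-distribʳ-sum (sum g) f) (sum-cong-≗ λ i → *-distribˡ-sum (f i) g)

∑-δ : ∀ {n} (i : Fin n) → ∑[ j < n ] δ i j ≡ 1
∑-δ {suc n} zero    = cong suc (∑-zero n)
∑-δ {suc n} (suc i) = ∑-δ {n} i

∑-fibres : ∀ {m n} (g : Fin m → Fin n) (w : Fin m → ℕ) →
           ∑[ d < n ] ∑[ i < m ] (w i * δ (g i) d) ≡ sum w
∑-fibres {m} {n} g w = begin
  ∑[ d < n ] ∑[ i < m ] (w i * δ (g i) d) ≡⟨ ∑-comm (λ i d → w i * δ (g i) d) ⟨
  ∑[ i < m ] ∑[ d < n ] (w i * δ (g i) d) ≡⟨ sum-cong-≗ (λ i → *-distribˡ-sum (w i) (δ (g i))) ⟨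
  ∑[ i < m ] (w i * ∑[ d < n ] δ (g i) d) ≡⟨ sum-cong-≗ (λ i → cong (w i *_) (∑-δ (g i))) ⟩
  ∑[ i < m ] (w i * 1)                   ≡⟨ sum-cong-≗ (λ i → *-identityʳ (w i)) ⟩
  sum w                                 ∎
  where open ≡-Reasoning

∑-fibres-count : ∀ {m n} (g : Fin m → Fin n) → ∑[ d < n ] ∑[ i < m ] δ (g i) d ≡ m
∑-fibres-count {m} {n} g = begin
  ∑[ d < n ] ∑[ i < m ] δ (g i) d
    ≡⟨ sum-cong-≗ (λ d → sum-cong-≗ λ i → *-identityˡ (δ (g i) d)) ⟨
  ∑[ d < n ] ∑[ i < m ] (1 * δ (g i) d)
    ≡⟨ ∑-fibres g (λ _ → 1) ⟩
  ∑[ i < m ] 1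
    ≡⟨ trans (∑-const m 1) (*-identityʳ m) ⟩
  m ∎
  where open ≡-Reasoning

count≤∑-injective : ∀ {m n p} {P : Fin m → Set p} (P? : ∀ i → Dec (P i)) (g : Fin m → Fin n)
  (B : Fin n → ℕ) →
  (∀ {i j} → P i → P j → g i ≡ g j → i ≡ j) → (∀ {i} → P i → 0 < B (g i)) →
  ∑[ i < m ] 𝟙 (P? i) ≤ sum B
count≤∑-injective {m} {n} P? g B injective inSupport = begin
  ∑[ i < m ] 𝟙 (P? i)                         ≡⟨ ∑-fibres g (λ i → 𝟙 (P? i)) ⟨
  ∑[ d < n ] ∑[ i < m ] (𝟙 (P? i) * δ (g i) d) ≤⟨ ∑-mono-≤ fibre≤ ⟩
  sum B                                        ∎
  where
  open ≤-Reasoning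
  fibre≤ : ∀ d → ∑[ i < m ] (𝟙 (P? i) * δ (g i) d) ≤ B d
  fibre≤ d with ∑[ i < m ] (𝟙 (P? i) * δ (g i) d) ℕ.≟ 0
  ... | yes ≡0 = ≤-trans (≤-reflexive ≡0) z≤n
  ... | no  ≢0 = let i , pos = ∑-pos⇒∃ _ (n≢0⇒n>0 ≢0)
                     Pi , gi≡d = 𝟙*𝟙-witness (P? i) (g i ≟ d) pos
                 in ≤-trans (∑-≤1 _ (λ i → 𝟙*𝟙≤1 (P? i) (g i ≟ d)) unique)
                            (subst (λ d → 0 < B d) gi≡d (inSupport Pi))
    where
    unique : ∀ i j → 0 < 𝟙 (P? i) * δ (g i) d → 0 < 𝟙 (P? j) * δ (g j) d → i ≡ j
    unique i j posᵢ posⱼ = let Pi , gi≡d = 𝟙*𝟙-witness (P? i) (g i ≟ d) posᵢ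
                               Pj , gj≡d = 𝟙*𝟙-witness (P? j) (g j ≟ d) posⱼ
                           in injective Pi Pj (trans gi≡d (sym gj≡d))

∑-≥-with-exceptions : ∀ {c p} {B : Fin c → Set p} (B? : ∀ y → Dec (B y)) (f : Fin c → ℕ) {lo hi} →
  (∀ y → lo ≤ f y) → (∀ y → ¬ B y → hi ≤ f y) →
  c * hi + lo * ∑[ y < c ] 𝟙 (B? y) ≤ sum f + hi * ∑[ y < c ] 𝟙 (B? y)
∑-≥-with-exceptions {c} B? f {lo} {hi} lo≤f hi≤f = begin
  c * hi + lo * ∑[ y < c ] 𝟙 (B? y)           ≡⟨ cong₂ _+_ (sym (∑-const c hi)) (*-distribˡ-sum lo (λ y → 𝟙 (B? y))) ⟩
  ∑[ y < c ] hi + ∑[ y < c ] (lo * 𝟙 (B? y))  ≡⟨ ∑-distrib-+ (λ _ → hi) (λ y → lo * 𝟙 (B? y)) ⟨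
  ∑[ y < c ] (hi + lo * 𝟙 (B? y))             ≤⟨ ∑-mono-≤ pointwise ⟩
  ∑[ y < c ] (f y + hi * 𝟙 (B? y))            ≡⟨ ∑-distrib-+ f (λ y → hi * 𝟙 (B? y)) ⟩
  sum f + ∑[ y < c ] (hi * 𝟙 (B? y))          ≡⟨ cong (_+_ (sum f)) (*-distribˡ-sum hi (λ y → 𝟙 (B? y))) ⟨
  sum f + hi * ∑[ y < c ] 𝟙 (B? y)            ∎
  where
  open ≤-Reasoning
  pointwise : ∀ y → hi + lo * 𝟙 (B? y) ≤ f y + hi * 𝟙 (B? y)
  pointwise y with B? y
  ... | yes _ = ≤-trans (≤-reflexive (+-comm hi (lo * 1)))
                  (+-mono-≤ (≤-trans (≤-reflexive (*-identityʳ lo)) (lo≤f y))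
                            (≤-reflexive (sym (*-identityʳ hi))))
  ... | no ¬b = +-mono-≤ (hi≤f y ¬b) (≤-reflexive (trans (*-zeroʳ lo) (sym (*-zeroʳ hi))))

∑-≥-mostly-large : ∀ {c p} {B : Fin c → Set p} (B? : ∀ y → Dec (B y)) (f : Fin c → ℕ) {γ lo hi} →
  ∑[ y < c ] 𝟙 (B? y) ≤ γ → γ ≤ c → lo ≤ hi →
  (∀ y → lo ≤ f y) → (∀ y → ¬ B y → hi ≤ f y) →
  γ * lo + (c ∸ γ) * hi ≤ sum f
∑-≥-mostly-large {c} B? f {γ} {lo} {hi} K≤γ γ≤c lo≤hi lo≤f hi≤f = +-cancelˡ-≤ (hi * K) _ _ (begin
  hi * K + (γ * lo + (c ∸ γ) * hi)     ≡⟨ cong (λ w → hi * K + (γ * lo + w * hi)) c∸γ≡v ⟨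
  hi * K + (γ * lo + v * hi)           ≡⟨ cong (λ w → hi * K + (w * lo + v * hi)) K+u≡γ ⟨
  hi * K + ((K + u) * lo + v * hi)     ≡⟨ cong (λ w → hi * K + (w + v * hi)) (*-distribʳ-+ lo K u) ⟩
  hi * K + (K * lo + u * lo + v * hi)  ≤⟨ +-monoʳ-≤ (hi * K) (+-monoˡ-≤ (v * hi)
                                            (+-monoʳ-≤ (K * lo) (*-monoʳ-≤ u lo≤hi))) ⟩
  hi * K + (K * lo + u * hi + v * hi)  ≡⟨ regroup K u v lo hi ⟩
  (K + u + v) * hi + lo * K            ≡⟨ cong (λ w → w * hi + lo * K) K+u+v≡c ⟩
  c * hi + lo * K                      ≤⟨ ∑-≥-with-exceptions B? f lo≤f hi≤f ⟩
  sum f + hi * K                       ≡⟨ +-comm (sum f) (hi * K) ⟩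
  hi * K + sum f                       ∎)
  where
  open ≤-Reasoning
  K = ∑[ y < c ] 𝟙 (B? y)
  u = proj₁ (m≤n⇒∃[o]m+o≡n K≤γ)
  K+u≡γ : K + u ≡ γ
  K+u≡γ = proj₂ (m≤n⇒∃[o]m+o≡n K≤γ)
  v = proj₁ (m≤n⇒∃[o]m+o≡n γ≤c)
  γ+v≡c : γ + v ≡ c
  γ+v≡c = proj₂ (m≤n⇒∃[o]m+o≡n γ≤c)
  K+u+v≡c : K + u + v ≡ c
  K+u+v≡c = trans (cong (_+ v) K+u≡γ) γ+v≡c
  c∸γ≡v : c ∸ γ ≡ v
  c∸γ≡v = trans (cong (_∸ γ) (sym γ+v≡c)) (m+n∸m≡n γ v)
  regroup : ∀ K u v lo hi → hi * K + (K * lo + u * hi + v * hi) ≡ (K + u + v) * hi + lo * K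
  regroup = solve-∀

length-filter-tabulate : ∀ {a p} {A : Set a} {P : A → Set p} (P? : ∀ x → Dec (P x))
  {n} (g : Fin n → A) → length (filter P? (tabulate g)) ≡ ∑[ i < n ] 𝟙 (P? (g i))
length-filter-tabulate P? {zero} g = refl
length-filter-tabulate P? {suc n} g with P? (g zero)
... | yes _ = cong suc (length-filter-tabulate P? (g ∘ suc))
... | no _  = length-filter-tabulate P? (g ∘ suc)

minimiser : ∀ {n} (f : Fin n → ℕ) → Fin n → Σ (Fin n) λ i → ∀ j → f i ≤ f j
minimiser f i₀ = argmin f i₀ (allFin _) , λ j → All.lookup (f[argmin]≤f[xs] i₀ (allFin _)) (∈-allFin j)

maximiser : ∀ {n} (f : Fin n → ℕ) → Fin n → Σ (Fin n) λ i → ∀ j → f j ≤ f i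
maximiser f i₀ = argmax f i₀ (allFin _) , λ j → All.lookup (f[xs]≤f[argmax] i₀ (allFin _)) (∈-allFin j)

m*n≤m : ∀ m {n} → n ≤ 1 → m * n ≤ m
m*n≤m m n≤1 = ≤-trans (*-monoʳ-≤ m n≤1) (≤-reflexive (*-identityʳ m))

[1+2p]a≤a²+[1+p]p : ∀ p a → (1 + 2 * p) * a ≤ a * a + suc p * p
[1+2p]a≤a²+[1+p]p p a with a ≤? p
... | yes a≤p = let e , a+e≡p = m≤n⇒∃[o]m+o≡n a≤p in
  subst (λ p → (1 + 2 * p) * a ≤ a * a + suc p * p) a+e≡p
    (≤-trans (m≤m+n _ (e * suc e)) (≤-reflexive (expand a e)))
  where
  expand : ∀ a e → (1 + 2 * (a + e)) * a + e * suc e ≡ a * a + suc (a + e) * (a + e)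
  expand = solve-∀
... | no  a≰p = let e , 1+p+e≡a = m≤n⇒∃[o]m+o≡n (≰⇒> a≰p) in
  subst (λ a → (1 + 2 * p) * a ≤ a * a + suc p * p) 1+p+e≡a
    (≤-trans (m≤m+n _ (e * suc e)) (≤-reflexive (expand p e)))
  where
  expand : ∀ p e → (1 + 2 * p) * (suc p + e) + e * suc e ≡ (suc p + e) * (suc p + e) + suc p * p
  expand = solve-∀

4mn≤[m+n]² : ∀ m n → 4 * m * n ≤ (m + n) * (m + n)
4mn≤[m+n]² m n with ≤-total m n
... | inj₁ m≤n = let e , m+e≡n = m≤n⇒∃[o]m+o≡n m≤n in
  subst (λ n → 4 * m * n ≤ (m + n) * (m + n)) m+e≡n (≤-trans (m≤m+n _ (e * e)) (≤-reflexive (expand m e)))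
  where
  expand : ∀ m e → 4 * m * (m + e) + e * e ≡ (m + (m + e)) * (m + (m + e))
  expand = solve-∀
... | inj₂ n≤m = let e , n+e≡m = m≤n⇒∃[o]m+o≡n n≤m in
  subst (λ m → 4 * m * n ≤ (m + n) * (m + n)) n+e≡m (≤-trans (m≤m+n _ (e * e)) (≤-reflexive (expand n e)))
  where
  expand : ∀ n e → 4 * (n + e) * n + e * e ≡ (n + e + n) * (n + e + n)
  expand = solve-∀

[x+y]²an≤[xn+ya]² : ∀ {x y n a} → x ≤ y → n ≤ a →
                    (x + y) * (x + y) * (a * n) ≤ (x * n + y * a) * (x * n + y * a)
[x+y]²an≤[xn+ya]² {x} {y} {n} {a} x≤y n≤a =
  let f , x+f≡y = m≤n⇒∃[o]m+o≡n x≤y ; e , n+e≡a = m≤n⇒∃[o]m+o≡n n≤a in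
  subst₂ (λ y a → (x + y) * (x + y) * (a * n) ≤ (x * n + y * a) * (x * n + y * a)) x+f≡y n+e≡a
    (≤-trans (m≤m+n _ _) (≤-reflexive (expand x f n e)))
  where
  expand : ∀ x f n e → (x + (x + f)) * (x + (x + f)) * ((n + e) * n)
                         + e * ((x + f) * (x + f) * e + (2 * x * f + f * f) * n)
                       ≡ (x * n + (x + f) * (n + e)) * (x * n + (x + f) * (n + e))
  expand = solve-∀

square-mono : ∀ {m n} → m ≤ n → m * m ≤ n * n
square-mono m≤n = *-mono-≤ m≤n m≤n

Lb4≤-intro : ∀ {t s c γ r} n a M → γ ≤ c → s ≤ a * n → n ≤ M → a ≤ M →
             γ * n + (c ∸ γ) * M ≤ r * t * γ → Lb4≤ t s c γ r
Lb4≤-intro {t} {s} {c} {γ} {r} n a M γ≤c s≤an n≤M a≤M P≤R with γ <? (c ∸ γ)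
... | yes γ<g = begin
  s * (c * c)
    ≤⟨ *-monoˡ-≤ (c * c) (≤-trans s≤an (*-monoˡ-≤ n (m≤m⊔n a n))) ⟩
  (a ⊔ n) * n * (c * c)
    ≡⟨ cong (λ c → (a ⊔ n) * n * (c * c)) (m+[n∸m]≡n γ≤c) ⟨
  (a ⊔ n) * n * ((γ + g) * (γ + g))
    ≡⟨ regroup (a ⊔ n) n γ g ⟩
  (γ + g) * (γ + g) * ((a ⊔ n) * n)
    ≤⟨ [x+y]²an≤[xn+ya]² (<⇒≤ γ<g) (m≤n⊔m a n) ⟩
  (γ * n + g * (a ⊔ n)) * (γ * n + g * (a ⊔ n))
    ≤⟨ square-mono (+-monoʳ-≤ (γ * n) (*-monoʳ-≤ g (⊔-lub a≤M n≤M))) ⟩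
  (γ * n + g * M) * (γ * n + g * M)
    ≤⟨ square-mono P≤R ⟩
  (r * t * γ) * (r * t * γ)
    ∎
  where
  open ≤-Reasoning
  g = c ∸ γ
  regroup : ∀ A n γ g → A * n * ((γ + g) * (γ + g)) ≡ (γ + g) * (γ + g) * (A * n)
  regroup = solve-∀
... | no _ = begin
  4 * s * γ * g                        ≤⟨ *-monoˡ-≤ g (*-monoˡ-≤ γ (*-monoʳ-≤ 4 s≤an)) ⟩
  4 * (a * n) * γ * g                  ≡⟨ regroup a n γ g ⟩
  4 * (γ * n) * (g * a)                ≤⟨ 4mn≤[m+n]² (γ * n) (g * a) ⟩
  (γ * n + g * a) * (γ * n + g * a)    ≤⟨ square-mono (+-monoʳ-≤ (γ * n) (*-monoʳ-≤ g a≤M)) ⟩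
  (γ * n + g * M) * (γ * n + g * M)    ≤⟨ square-mono P≤R ⟩
  (r * t * γ) * (r * t * γ)            ∎
  where
  open ≤-Reasoning
  g = c ∸ γ
  regroup : ∀ a n γ g → 4 * (a * n) * γ * g ≡ 4 * (γ * n) * (g * a)
  regroup = solve-∀

seatedAt : ∀ {t} → Maybe (Fin t) → Fin t → ℕ
seatedAt m k = 𝟙 (≡-dec _≟_ m (just k))

attends : ∀ {a} {A : Set a} → Maybe A → ℕ
attends nothing  = 0
attends (just _) = 1

seatedAt≤1 : ∀ {t} (m : Maybe (Fin t)) k → seatedAt m k ≤ 1
seatedAt≤1 m k = 𝟙≤1 (≡-dec _≟_ m (just k))

attends≤1 : ∀ {a} {A : Set a} (s : Maybe A) → attends s ≤ 1
attends≤1 nothing  = z≤n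
attends≤1 (just _) = ≤-refl

∑-seatedAt : ∀ {t} (m : Maybe (Fin t)) → ∑[ k < t ] seatedAt m k ≡ attends m
∑-seatedAt {t} nothing = ∑-zero t
∑-seatedAt (just i)    = ∑-δ i

numAt≡∑-seatedAt : ∀ {m t} (f : Fin m → Maybe (Fin t)) k → numAt f k ≡ ∑[ x < m ] seatedAt (f x) k
numAt≡∑-seatedAt f k = length-filter-tabulate (λ x → ≡-dec _≟_ (f x) (just k)) id

module Seating {n t m : ℕ} (seat : Fin n → Fin m → Maybe (Fin t)) where

  attendance : Fin m → ℕ
  attendance x = ∑[ d < n ] attends (seat d x)

  attendance≤n : ∀ x → attendance x ≤ n
  attendance≤n x = ≤-trans (∑-≤-const (λ d → attends≤1 (seat d x))) (≤-reflexive (*-identityʳ n))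

  ∑-attendance≡∑-numAt : ∑[ x < m ] attendance x ≡ ∑[ d < n ] ∑[ k < t ] numAt (seat d) k
  ∑-attendance≡∑-numAt = begin
    ∑[ x < m ] ∑[ d < n ] attends (seat d x)
      ≡⟨ ∑-comm (λ x d → attends (seat d x)) ⟩
    ∑[ d < n ] ∑[ x < m ] attends (seat d x)
      ≡⟨ sum-cong-≗ (λ d → sum-cong-≗ λ x → ∑-seatedAt (seat d x)) ⟨
    ∑[ d < n ] ∑[ x < m ] ∑[ k < t ] seatedAt (seat d x) k
      ≡⟨ sum-cong-≗ (λ d → ∑-comm (λ x k → seatedAt (seat d x) k)) ⟩
    ∑[ d < n ] ∑[ k < t ] ∑[ x < m ] seatedAt (seat d x) k
      ≡⟨ sum-cong-≗ (λ d → sum-cong-≗ λ k → numAt≡∑-seatedAt (seat d) k) ⟨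
    ∑[ d < n ] ∑[ k < t ] numAt (seat d) k
      ∎
    where open ≡-Reasoning

  ∑-attendance≤ : ∀ {cap} → (∀ d k → numAt (seat d) k ≤ cap) → ∑[ x < m ] attendance x ≤ n * (t * cap)
  ∑-attendance≤ numAt≤cap = begin
    ∑[ x < m ] attendance x                 ≡⟨ ∑-attendance≡∑-numAt ⟩
    ∑[ d < n ] ∑[ k < t ] numAt (seat d) k  ≤⟨ ∑-≤-const (λ d → ∑-≤-const (numAt≤cap d)) ⟩
    n * (t * _)                             ∎
    where open ≤-Reasoning

  SharesTable : Fin n → Fin m → Fin m → Set
  SharesTable d x x' = Σ (Fin t) λ k → (seat d x ≡ just k) × (seat d x' ≡ just k)

  coincidences : Fin m → Fin m → ℕ
  coincidences x x' = ∑[ d < n ] ∑[ k < t ] (seatedAt (seat d x) k * seatedAt (seat d x') k)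

  ∑-numAt²≡∑-coincidences :
    ∑[ d < n ] ∑[ k < t ] (numAt (seat d) k * numAt (seat d) k) ≡ ∑[ x < m ] ∑[ x' < m ] coincidences x x'
  ∑-numAt²≡∑-coincidences = begin
    ∑[ d < n ] ∑[ k < t ] (numAt (seat d) k * numAt (seat d) k)
      ≡⟨ sum-cong-≗ (λ d → sum-cong-≗ λ k → trans (cong₂ _*_ (numAt≡∑-seatedAt (seat d) k)
                                                             (numAt≡∑-seatedAt (seat d) k))
                                                  (∑*∑ (λ x → seatedAt (seat d x) k) (λ x → seatedAt (seat d x) k))) ⟩
    ∑[ d < n ] ∑[ k < t ] ∑[ x < m ] ∑[ x' < m ] pair d k x x'
      ≡⟨ sum-cong-≗ (λ d → ∑-comm (λ k x → ∑[ x' < m ] pair d k x x')) ⟩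
    ∑[ d < n ] ∑[ x < m ] ∑[ k < t ] ∑[ x' < m ] pair d k x x'
      ≡⟨ sum-cong-≗ (λ d → sum-cong-≗ λ x → ∑-comm (λ k x' → pair d k x x')) ⟩
    ∑[ d < n ] ∑[ x < m ] ∑[ x' < m ] ∑[ k < t ] pair d k x x'
      ≡⟨ ∑-comm (λ d x → ∑[ x' < m ] ∑[ k < t ] pair d k x x') ⟩
    ∑[ x < m ] ∑[ d < n ] ∑[ x' < m ] ∑[ k < t ] pair d k x x'
      ≡⟨ sum-cong-≗ (λ x → ∑-comm (λ d x' → ∑[ k < t ] pair d k x x')) ⟩
    ∑[ x < m ] ∑[ x' < m ] coincidences x x'
      ∎
    where
    open ≡-Reasoning
    pair : Fin n → Fin t → Fin m → Fin m → ℕ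
    pair d k x x' = seatedAt (seat d x) k * seatedAt (seat d x') k

  AtMostOnce : Set
  AtMostOnce = ∀ x x' → x ≢ x' → ∀ d d' → SharesTable d x x' → SharesTable d' x x' → d ≡ d'

  coincidences-self≤attendance : ∀ x → coincidences x x ≤ attendance x
  coincidences-self≤attendance x = ∑-mono-≤ λ d → begin
    ∑[ k < t ] (seatedAt (seat d x) k * seatedAt (seat d x) k)
      ≤⟨ ∑-mono-≤ (λ k → m*n≤m _ (seatedAt≤1 (seat d x) k)) ⟩
    ∑[ k < t ] seatedAt (seat d x) k
      ≡⟨ ∑-seatedAt (seat d x) ⟩
    attends (seat d x)
      ∎
    where open ≤-Reasoning

  coincidences≤1 : ∀ {x x'} → (∀ d d' → SharesTable d x x' → SharesTable d' x x' → d ≡ d') →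
                   coincidences x x' ≤ 1
  coincidences≤1 {x} {x'} once =
    ∑-≤1 perDinner perDinner≤1 λ d d' p q → once d d' (sharesTable d p) (sharesTable d' q)
    where
    perDinner : Fin n → ℕ
    perDinner d = ∑[ k < t ] (seatedAt (seat d x) k * seatedAt (seat d x') k)
    perDinner≤1 : ∀ d → perDinner d ≤ 1
    perDinner≤1 d = begin
      perDinner d                       ≤⟨ ∑-mono-≤ (λ k → m*n≤m _ (seatedAt≤1 (seat d x') k)) ⟩
      ∑[ k < t ] seatedAt (seat d x) k  ≡⟨ ∑-seatedAt (seat d x) ⟩
      attends (seat d x)                ≤⟨ attends≤1 (seat d x) ⟩
      1                                 ∎
      where open ≤-Reasoning
    sharesTable : ∀ d → 0 < perDinner d → SharesTable d x x'
    sharesTable d p =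
      let k , pk = ∑-pos⇒∃ (λ k → seatedAt (seat d x) k * seatedAt (seat d x') k) p
      in k , 𝟙*𝟙-witness (≡-dec _≟_ (seat d x) (just k)) (≡-dec _≟_ (seat d x') (just k)) pk

  ∑-coincidences≤ : AtMostOnce →
    ∑[ x < m ] ∑[ x' < m ] coincidences x x' ≤ ∑[ x < m ] attendance x + m * (m ∸ 1)
  ∑-coincidences≤ once = begin
    ∑[ x < m ] ∑[ x' < m ] coincidences x x'            ≤⟨ ∑-mono-≤ (λ x → ∑-≤-except (coincidences x) x
                                                             (coincidences-self≤attendance x)
                                                             λ x' x'≢x → coincidences≤1 (once x x' (x'≢x ∘ sym))) ⟩
    ∑[ x < m ] (attendance x + (m ∸ 1) * 1)             ≡⟨ ∑-distrib-+ attendance (λ _ → (m ∸ 1) * 1) ⟩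
    ∑[ x < m ] attendance x + ∑[ x < m ] ((m ∸ 1) * 1)  ≡⟨ cong (_+_ (∑[ x < m ] attendance x))
                                                             (trans (∑-const m _) (cong (m *_) (*-identityʳ (m ∸ 1)))) ⟩
    ∑[ x < m ] attendance x + m * (m ∸ 1)               ∎
    where open ≤-Reasoning

  ∑-attendance-pair-bound : AtMostOnce → ∀ p →
    2 * p * ∑[ x < m ] attendance x ≤ m * (m ∸ 1) + n * (t * (suc p * p))
  ∑-attendance-pair-bound once p = +-cancelˡ-≤ A _ _ (begin
    A + 2 * p * A                    ≡⟨⟩
    (1 + 2 * p) * A                  ≤⟨ [1+2p]A≤ ⟩
    Q + n * (t * P)                  ≤⟨ +-monoˡ-≤ (n * (t * P)) Q≤ ⟩
    A + m * (m ∸ 1) + n * (t * P)    ≡⟨ +-assoc A (m * (m ∸ 1)) (n * (t * P)) ⟩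
    A + (m * (m ∸ 1) + n * (t * P))  ∎)
    where
    open ≤-Reasoning
    A = ∑[ x < m ] attendance x
    Q = ∑[ d < n ] ∑[ k < t ] (numAt (seat d) k * numAt (seat d) k)
    P = suc p * p
    Q≤ : Q ≤ A + m * (m ∸ 1)
    Q≤ = subst (_≤ A + m * (m ∸ 1)) (sym ∑-numAt²≡∑-coincidences) (∑-coincidences≤ once)
    [1+2p]A≤ : (1 + 2 * p) * A ≤ Q + n * (t * P)
    [1+2p]A≤ = begin
      (1 + 2 * p) * A
        ≡⟨ cong ((1 + 2 * p) *_) ∑-attendance≡∑-numAt ⟩
      (1 + 2 * p) * ∑[ d < n ] ∑[ k < t ] a d k
        ≡⟨ *-distribˡ-sum (1 + 2 * p) (λ d → ∑[ k < t ] a d k) ⟩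
      ∑[ d < n ] ((1 + 2 * p) * ∑[ k < t ] a d k)
        ≡⟨ sum-cong-≗ (λ d → *-distribˡ-sum (1 + 2 * p) (a d)) ⟩
      ∑[ d < n ] ∑[ k < t ] ((1 + 2 * p) * a d k)
        ≤⟨ ∑-mono-≤ (λ d → ∑-mono-≤ λ k → [1+2p]a≤a²+[1+p]p p (a d k)) ⟩
      ∑[ d < n ] ∑[ k < t ] (a d k * a d k + P)
        ≡⟨ sum-cong-≗ (λ d → ∑-distrib-+ (λ k → a d k * a d k) (λ _ → P)) ⟩
      ∑[ d < n ] (∑[ k < t ] (a d k * a d k) + ∑[ k < t ] P)
        ≡⟨ ∑-distrib-+ (λ d → ∑[ k < t ] (a d k * a d k)) (λ _ → ∑[ k < t ] P) ⟩
      Q + ∑[ d < n ] ∑[ k < t ] P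
        ≡⟨ cong (_+_ Q) (trans (∑-const n _) (cong (n *_) (∑-const t P))) ⟩
      Q + n * (t * P)
        ∎
      where
      a : Fin n → Fin t → ℕ
      a d = numAt (seat d)

module Host {n t m : ℕ} (host : Fin n → Maybe (Fin t)) (guests : Fin n → Fin m → Maybe (Fin t))
            (meet : Fin m → Fin n)
            (meets : ∀ i → Σ (Fin t) λ k → (host (meet i) ≡ just k) × (guests (meet i) i ≡ just k)) where

  metAt : Fin n → ℕ
  metAt d = ∑[ i < m ] δ (meet i) d

  metAt-absent : ∀ {d} → host d ≡ nothing → metAt d ≡ 0
  metAt-absent {d} absent = trans (sum-cong-≗ λ i → 𝟙-no (meet i ≟ d) (present i)) (∑-zero m)
    where
    present : ∀ i → meet i ≢ d
    present i refl with meets i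
    ... | _ , hosted , _ = case trans (sym hosted) absent of λ ()

  metAt≤numAt : ∀ {d k} → host d ≡ just k → metAt d ≤ numAt (guests d) k
  metAt≤numAt {d} {k} hosted =
    ≤-trans (∑-mono-≤ atHostTable) (≤-reflexive (sym (numAt≡∑-seatedAt (guests d) k)))
    where
    atHostTable : ∀ i → δ (meet i) d ≤ seatedAt (guests d i) k
    atHostTable i with meet i ≟ d
    ... | no  _    = z≤n
    ... | yes refl with meets i
    ...   | k' , hosted' , seated = ≤-reflexive (sym (𝟙-yes (≡-dec _≟_ (guests d i) (just k))
                                      (trans seated (trans (sym hosted') hosted))))

  metAt≤ : ∀ {cap} → (∀ d k → numAt (guests d) k ≤ cap) → ∀ d → metAt d ≤ cap
  metAt≤ numAt≤cap d with host d in eq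
  ... | nothing = ≤-trans (≤-reflexive (metAt-absent eq)) z≤n
  ... | just k  = ≤-trans (metAt≤numAt eq) (numAt≤cap d k)

  m≤bound*attendance : ∀ {B} → (∀ d → metAt d ≤ B) → m ≤ B * ∑[ d < n ] attends (host d)
  m≤bound*attendance {B} metAt≤B = begin
    m                                   ≡⟨ ∑-fibres-count meet ⟨
    ∑[ d < n ] metAt d                  ≤⟨ ∑-mono-≤ perDinner ⟩
    ∑[ d < n ] (B * attends (host d))   ≡⟨ *-distribˡ-sum B (λ d → attends (host d)) ⟨
    B * ∑[ d < n ] attends (host d)     ∎
    where
    open ≤-Reasoning
    perDinner : ∀ d → metAt d ≤ B * attends (host d)
    perDinner d with host d in eq
    ... | nothing = ≤-trans (≤-reflexive (metAt-absent eq)) z≤n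
    ... | just _  = ≤-trans (metAt≤B d) (≤-reflexive (sym (*-identityʳ B)))

module FeasibleSchedule {n t s c σ γ : ℕ} {S : Schedule n t s c} (F : Feasible σ γ S) where
  open Schedule S
  open Feasible F

  supAttendance : Fin s → ℕ
  supAttendance = Seating.attendance supSeat

  cusAttendance : Fin c → ℕ
  cusAttendance = Seating.attendance cusSeat

  meeting : Fin s → Fin c → Fin n
  meeting x y = proj₁ (meetOnce x y)

  meeting-table : ∀ x y → SCmeet S (meeting x y) x y
  meeting-table x y = proj₂ (meetOnce x y)

  module SupplierHost (x : Fin s) = Host (λ d → supSeat d x) cusSeat (meeting x) (meeting-table x)

  meeting-table′ : ∀ y x → Σ (Fin t) λ k → (cusSeat (meeting x y) y ≡ just k) ×
                                           (supSeat (meeting x y) x ≡ just k)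
  meeting-table′ y x = Product.map₂ Product.swap (meeting-table x y)

  module CustomerHost (y : Fin c) = Host (λ d → cusSeat d y) supSeat (λ x → meeting x y) (meeting-table′ y)

  c≤γ*supAttendance : ∀ x → c ≤ γ * supAttendance x
  c≤γ*supAttendance x = SupplierHost.m≤bound*attendance x (SupplierHost.metAt≤ x capC)

  s≤σ*cusAttendance : ∀ y → s ≤ σ * cusAttendance y
  s≤σ*cusAttendance y = CustomerHost.m≤bound*attendance y (CustomerHost.metAt≤ y capS)

  s≤n*σ : Fin c → s ≤ n * σ
  s≤n*σ y = ≤-trans (s≤σ*cusAttendance y)
                    (≤-trans (*-monoʳ-≤ σ (Seating.attendance≤n cusSeat y)) (≤-reflexive (*-comm σ n)))

  c≤n*γ : Fin s → c ≤ n * γ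
  c≤n*γ x = ≤-trans (c≤γ*supAttendance x)
                    (≤-trans (*-monoʳ-≤ γ (Seating.attendance≤n supSeat x)) (≤-reflexive (*-comm γ n)))

  s*L≤n*[t*σ] : ∀ {L} → (∀ x → L ≤ supAttendance x) → s * L ≤ n * (t * σ)
  s*L≤n*[t*σ] L≤ = ≤-trans (∑-≥-const L≤) (Seating.∑-attendance≤ supSeat capS)

  2psL≤s[s-1]+nt[1+p]p : ∀ {L} → (∀ x → L ≤ supAttendance x) → ∀ p →
                         2 * p * s * L ≤ s * (s ∸ 1) + n * (t * (suc p * p))
  2psL≤s[s-1]+nt[1+p]p {L} L≤ p = begin
    2 * p * s * L                                ≡⟨ *-assoc (2 * p) s L ⟩
    2 * p * (s * L)                              ≤⟨ *-monoʳ-≤ (2 * p) (∑-≥-const L≤) ⟩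
    2 * p * ∑[ x < s ] supAttendance x           ≤⟨ Seating.∑-attendance-pair-bound supSeat atMostOnce p ⟩
    s * (s ∸ 1) + n * (t * (suc p * p))          ∎
    where open ≤-Reasoning

  sits-with-customer : ∀ {x y d k} → meeting x y ≡ d → cusSeat d y ≡ just k → supSeat d x ≡ just k
  sits-with-customer {x} {y} refl cy = let k' , sx , cy' = meeting-table x y in
    subst (λ k → supSeat _ x ≡ just k) (just-injective (trans (sym cy') cy)) sx

  sits-with-supplier : ∀ {x y d k} → meeting x y ≡ d → supSeat d x ≡ just k → cusSeat d y ≡ just k
  sits-with-supplier {x} {y} refl sx = let k' , sx' , cy = meeting-table x y in
    subst (λ k → cusSeat _ y ≡ just k) (just-injective (trans (sym sx') sx)) cy

  meeting-injective : ∀ {y₀ y d k x x'} → cusSeat d y₀ ≡ just k → cusSeat d y ≢ just k →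
    meeting x y₀ ≡ d → meeting x' y₀ ≡ d → meeting x y ≡ meeting x' y → x ≡ x'
  meeting-injective {y₀} {y} {d} {k} {x} {x'} y₀-at-k y-not-at-k x-meets x'-meets same with x ≟ x'
  ... | yes x≡x' = x≡x'
  ... | no  x≢x' = ⊥-elim (y-not-at-k (sits-with-supplier (sym d≡d') (sits-with-customer x-meets y₀-at-k)))
    where
    d' = meeting x y
    shared-at-d : SSmeet S d x x'
    shared-at-d = k , sits-with-customer x-meets y₀-at-k , sits-with-customer x'-meets y₀-at-k
    shared-at-d' : SSmeet S d' x x'
    shared-at-d' = let k' , sx , cy = meeting-table x y in k' , sx , sits-with-customer (sym same) cy
    d≡d' : d ≡ d'
    d≡d' = atMostOnce x x' x≢x' d d' shared-at-d shared-at-d'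

  metAt≤cusAttendance : ∀ {y₀ y d k} → cusSeat d y₀ ≡ just k → cusSeat d y ≢ just k →
                        CustomerHost.metAt y₀ d ≤ cusAttendance y
  metAt≤cusAttendance {y₀} {y} {d} y₀-at-k y-not-at-k =
    count≤∑-injective (λ x → meeting x y₀ ≟ d) (λ x → meeting x y) (λ d → attends (cusSeat d y))
      (meeting-injective y₀-at-k y-not-at-k) seated
    where
    seated : ∀ {x} → meeting x y₀ ≡ d → 0 < attends (cusSeat (meeting x y) y)
    seated {x} _ with cusSeat (meeting x y) y | proj₂ (proj₂ (meeting-table x y))
    ... | just _ | _ = s≤s z≤n

  lb4≤n : γ ≤ c → Fin s → Fin c → Lb4≤ t s c γ n
  lb4≤n γ≤c x y = Lb4≤-intro n₀ a (n₀ ⊔ a) γ≤c s≤a*n₀ (m≤m⊔n n₀ a) (m≤n⊔m n₀ a)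
    (≤-trans (∑-≥-mostly-large (λ y → ≡-dec _≟_ (cusSeat d* y) (just k*)) cusAttendance
                                K≤γ γ≤c (m≤m⊔n n₀ a) n₀-minimal far)
             (≤-trans (Seating.∑-attendance≤ cusSeat capC) (≤-reflexive (sym (*-assoc n t γ)))))
    where
    y₀ = proj₁ (minimiser cusAttendance y)
    n₀-minimal : ∀ y → cusAttendance y₀ ≤ cusAttendance y
    n₀-minimal = proj₂ (minimiser cusAttendance y)
    n₀ = cusAttendance y₀
    open CustomerHost y₀ using (metAt; metAt-absent; m≤bound*attendance)
    d* = proj₁ (maximiser metAt (meeting x y₀))
    d*-maximal : ∀ d → metAt d ≤ metAt d*
    d*-maximal = proj₂ (maximiser metAt (meeting x y₀))
    a = metAt d*
    s≤a*n₀ : s ≤ a * n₀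
    s≤a*n₀ = m≤bound*attendance d*-maximal
    a>0 : 0 < a
    a>0 = ≤-trans (≤-reflexive (sym (𝟙-yes (meeting x y₀ ≟ meeting x y₀) refl)))
                  (≤-trans (f≤∑ (λ x' → δ (meeting x' y₀) (meeting x y₀)) x) (d*-maximal (meeting x y₀)))
    y₀-seated : Σ (Fin t) λ k → cusSeat d* y₀ ≡ just k
    y₀-seated with cusSeat d* y₀ in eq
    ... | just k  = k , refl
    ... | nothing = ⊥-elim (<⇒≢ a>0 (sym (metAt-absent eq)))
    k* = proj₁ y₀-seated
    K≤γ : ∑[ y < c ] seatedAt (cusSeat d* y) k* ≤ γ
    K≤γ = ≤-trans (≤-reflexive (sym (numAt≡∑-seatedAt (cusSeat d*) k*))) (capC d* k*)
    far : ∀ y → cusSeat d* y ≢ just k* → n₀ ⊔ a ≤ cusAttendance y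
    far y y-elsewhere = ⊔-lub (n₀-minimal y) (metAt≤cusAttendance (proj₂ y₀-seated) y-elsewhere)

↥<[1+floor]*↧ : ∀ p → ↥ p ℤ.< ℤ.suc (floor p) ℤ.* ↧ p
↥<[1+floor]*↧ (mkℚ n d _) =
  subst (λ f → n ℤ.< ℤ.suc f ℤ.* + suc d) (sym (div-pos-is-/ℕ n (suc d))) (n<s[n/ℕd]*d n (suc d))

ceiling≤ : ∀ q r → ↥ q ℤ.≤ + r ℤ.* ↧ q → ceiling q ℤ.≤ + r
ceiling≤ q@record{} r ↥q≤r↧q = ℤ.≤-trans (ℤ.neg-mono-≤ -r≤f) (ℤ.≤-reflexive (ℤ.neg-involutive (+ r)))
  where
  f = floor (ℚ.- q)
  -r≤f : ℤ.- + r ℤ.≤ f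
  -r≤f = ℤ.≮⇒≥ λ f<-r → ℤ.<-irrefl refl (ℤ.≤-<-trans (begin
    ℤ.suc f ℤ.* ↧ q          ≤⟨ ℤ.*-monoʳ-≤-nonNeg (↧ q) (ℤ.i<j⇒suc[i]≤j f<-r) ⟩
    ℤ.- + r ℤ.* ↧ q          ≡⟨ ℤ.neg-distribˡ-* (+ r) (↧ q) ⟨
    ℤ.- (+ r ℤ.* ↧ q)        ≤⟨ ℤ.neg-mono-≤ ↥q≤r↧q ⟩
    ℤ.- ↥ q                  ≡⟨ ↥-neg q ⟨
    ↥ (ℚ.- q)                ∎)
    (subst (λ d → ↥ (ℚ.- q) ℤ.< ℤ.suc f ℤ.* d) (↧-neg q) (↥<[1+floor]*↧ (ℚ.- q))))
    where open ℤ.≤-Reasoning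

-- In ℚᵘ the order unfolds definitionally to cross-multiplied integers, so the bounds are checked there.
ceiling≤-toℚᵘ : ∀ q r (u : ℚᵘ) → toℚᵘ q ≃ u → u ℚᵘ.≤ (+ r ℚᵘ./ 1) → ceiling q ℤ.≤ + r
ceiling≤-toℚᵘ q@record{} r u q≃u u≤r with ℚᵘ.≤-respˡ-≃ (ℚᵘ.≃-sym q≃u) u≤r
... | *≤* ↥q*1≤r*↧q = ceiling≤ q r (subst (ℤ._≤ + r ℤ.* ↧ q) (ℤ.*-identityʳ (↥ q)) ↥q*1≤r*↧q)

toℚᵘ-/ : ∀ i n .{{_ : NonZero n}} → toℚᵘ (i / n) ≃ (i ℚᵘ./ n)
toℚᵘ-/ i (suc n) = toℚᵘ-fromℚᵘ (mkℚᵘ i n)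

⌈a÷b⌉≤ : ∀ {a b r} .{{_ : NonZero b}} → a ℕ.≤ r * b → ⌈ a ÷ b ⌉ ℤ.≤ + r
⌈a÷b⌉≤ {a} {b@(suc _)} {r} a≤rb =
  ceiling≤-toℚᵘ (+ a / b) r (+ a ℚᵘ./ b) (toℚᵘ-/ (+ a) b) (*≤* (begin
  + a ℤ.* + 1   ≡⟨ ℤ.*-identityʳ (+ a) ⟩
  + a           ≤⟨ ℤ.+≤+ a≤rb ⟩
  + (r * b)   ≡⟨ ℤ.pos-* r b ⟩
  + r ℤ.* + b   ∎))
  where open ℤ.≤-Reasoning

ceiling-lb3≤ : ∀ s {T r L} (z : ℤ) .{{_ : NonZero T}} → z ℤ.≤ + L → s * L ℕ.≤ r * T →
               ceiling ((+ s / T) ℚ.* (z / 1)) ℤ.≤ + r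
ceiling-lb3≤ s {T@(suc _)} {r} {L} z z≤L sL≤rT = ceiling≤-toℚᵘ _ r ((+ s ℚᵘ./ T) ℚᵘ.* (z ℚᵘ./ 1))
  (ℚᵘ.≃-trans (toℚᵘ-homo-* (+ s / T) (z / 1)) (ℚᵘ.*-cong (toℚᵘ-/ (+ s) T) (toℚᵘ-/ z 1))) (*≤* (begin
    (+ s ℤ.* z) ℤ.* + 1    ≡⟨ ℤ.*-identityʳ _ ⟩
    + s ℤ.* z              ≤⟨ ℤ.*-monoˡ-≤-nonNeg (+ s) z≤L ⟩
    + s ℤ.* + L            ≡⟨ ℤ.pos-* s L ⟨
    + (s * L)              ≤⟨ ℤ.+≤+ (≤-trans sL≤rT (≤-reflexive (cong (r *_) (sym (*-identityʳ T))))) ⟩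
    + (r * (T * 1))    ≡⟨ ℤ.pos-* r (T * 1) ⟩
    + r ℤ.* + (T * 1)    ∎))
  where open ℤ.≤-Reasoning

i≤k+j⇒i-j≤k : ∀ {i j k} → i ℤ.≤ k ℤ.+ j → i ℤ.- j ℤ.≤ k
i≤k+j⇒i-j≤k {i} {j} {k} i≤k+j = ℤ.≤-trans (ℤ.+-monoˡ-≤ (ℤ.- j) i≤k+j) (ℤ.≤-reflexive (cancel k j))
  where
  cancel : ∀ k j → k ℤ.+ j ℤ.- j ≡ k
  cancel = ℤ-Solver.solve-∀

pos-*-* : ∀ a b c → + (a * b * c) ≡ + a ℤ.* + b ℤ.* + c
pos-*-* a b c = trans (ℤ.pos-* (a * b) c) (cong (ℤ._* + c) (ℤ.pos-* a b))

ceiling-lb5≤ : ∀ s {t r L} i (z : ℤ) .{{_ : NonZero t}} → z ℤ.≤ + L →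
  2 * suc i * s * L ≤ s * (s ∸ 1) + r * (t * (suc (suc i) * suc i)) →
  ceiling ((+ s / t) ℚ.* (((+ 2 / suc (suc i)) ℚ.* (z / 1)) ℚ.- (+ (s ∸ 1) / (suc (suc i) * suc i)))) ℤ.≤ + r
ceiling-lb5≤ s {t@(suc _)} {r} {L} i z z≤L 2psL≤ = ceiling≤-toℚᵘ _ r u q≃u (*≤* (begin
  (+ s ℤ.* ((+ 2 ℤ.* z) ℤ.* + j[j-1] ℤ.+ (ℤ.- + s₁) ℤ.* + (j * 1))) ℤ.* + 1
    ≡⟨ cong (λ w → (+ s ℤ.* ((+ 2 ℤ.* z) ℤ.* + j[j-1] ℤ.+ (ℤ.- + s₁) ℤ.* w)) ℤ.* + 1)
            (ℤ.pos-* j 1) ⟩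
  (+ s ℤ.* ((+ 2 ℤ.* z) ℤ.* + j[j-1] ℤ.+ (ℤ.- + s₁) ℤ.* (+ j ℤ.* + 1))) ℤ.* + 1
    ≡⟨ expand (+ s) z (+ j) (+ j[j-1]) (+ s₁) ⟩
  (+ s ℤ.* + 2 ℤ.* + j[j-1]) ℤ.* z ℤ.- + s ℤ.* + s₁ ℤ.* + j
    ≡⟨ cong₂ (λ a b → a ℤ.* z ℤ.- b) (pos-*-* s 2 j[j-1]) (pos-*-* s s₁ j) ⟨
  + (s * 2 * j[j-1]) ℤ.* z ℤ.- + (s * s₁ * j)
    ≤⟨ ℤ.+-monoˡ-≤ (ℤ.- + (s * s₁ * j)) (ℤ.*-monoˡ-≤-nonNeg (+ (s * 2 * j[j-1])) z≤L) ⟩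
  + (s * 2 * j[j-1]) ℤ.* + L ℤ.- + (s * s₁ * j)
    ≡⟨ cong (ℤ._- + (s * s₁ * j)) (ℤ.pos-* (s * 2 * j[j-1]) L) ⟨
  + (s * 2 * j[j-1] * L) ℤ.- + (s * s₁ * j)
    ≤⟨ i≤k+j⇒i-j≤k {j = + (s * s₁ * j)}
         (ℤ.≤-trans (ℤ.+≤+ scaled) (ℤ.≤-reflexive (ℤ.pos-+ (r * (t * (j * 1 * j[j-1]))) (s * s₁ * j)))) ⟩
  + (r * (t * (j * 1 * j[j-1])))
    ≡⟨ ℤ.pos-* r (t * (j * 1 * j[j-1])) ⟩
  + r ℤ.* + (t * (j * 1 * j[j-1])) ∎))
  where
  open ℤ.≤-Reasoning
  j = suc (suc i)
  j[j-1] = j * suc i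
  s₁ = s ∸ 1
  u = (+ s ℚᵘ./ t) ℚᵘ.* (((+ 2 ℚᵘ./ j) ℚᵘ.* (z ℚᵘ./ 1)) ℚᵘ.- (+ s₁ ℚᵘ./ j[j-1]))
  q≃u : toℚᵘ ((+ s / t) ℚ.* (((+ 2 / j) ℚ.* (z / 1)) ℚ.- (+ s₁ / j[j-1]))) ≃ u
  q≃u = ℚᵘ.≃-trans (toℚᵘ-homo-* (+ s / t) _) (ℚᵘ.*-cong (toℚᵘ-/ (+ s) t)
          (ℚᵘ.≃-trans (toℚᵘ-homo-+ ((+ 2 / j) ℚ.* (z / 1)) (ℚ.- (+ s₁ / j[j-1])))
            (ℚᵘ.+-cong (ℚᵘ.≃-trans (toℚᵘ-homo-* (+ 2 / j) (z / 1)) (ℚᵘ.*-cong (toℚᵘ-/ (+ 2) j) (toℚᵘ-/ z 1)))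
                       (ℚᵘ.≃-trans (toℚᵘ-homo‿- (+ s₁ / j[j-1])) (ℚᵘ.-‿cong (toℚᵘ-/ (+ s₁) j[j-1]))))))
  expand : ∀ s z j j[j-1] s₁ → (s ℤ.* ((+ 2 ℤ.* z) ℤ.* j[j-1] ℤ.+ (ℤ.- s₁) ℤ.* (j ℤ.* + 1))) ℤ.* + 1
                          ≡ (s ℤ.* + 2 ℤ.* j[j-1]) ℤ.* z ℤ.- s ℤ.* s₁ ℤ.* j
  expand = ℤ-Solver.solve-∀
  scaled : s * 2 * j[j-1] * L ≤ r * (t * (j * 1 * j[j-1])) + s * s₁ * j
  scaled = ≤-trans (≤-reflexive (regroup₁ s i L))
                   (≤-trans (*-monoʳ-≤ j 2psL≤) (≤-reflexive (regroup₂ s s₁ r t i)))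
    where
    regroup₁ : ∀ s i L → s * 2 * (suc (suc i) * suc i) * L ≡ suc (suc i) * (2 * suc i * s * L)
    regroup₁ = solve-∀
    regroup₂ : ∀ s s₁ r t i → suc (suc i) * (s * s₁ + r * (t * (suc (suc i) * suc i)))
                              ≡ r * (t * (suc (suc i) * 1 * (suc (suc i) * suc i))) + s * s₁ * suc (suc i)
    regroup₂ = solve-∀

theorem1p2 : (t s c σ γ : ℕ) → .{{_ : NonZero t}} → .{{_ : NonZero s}} →
    .{{_ : NonZero c}} → .{{_ : NonZero σ}} → .{{_ : NonZero γ}} →
    γ < c → (r : ℕ) → IsOptimal t s c σ γ r →
      (⌈ s ÷ σ ⌉ ℤ.≤ + r)
    × (⌈ c ÷ γ ⌉ ℤ.≤ + r)
    × (ceiling ((_/_ (+ s) (t * σ) {{m*n≢0 t σ}}) ℚ.* ((⌈ c ÷ γ ⌉ / 1))) ℤ.≤ + r)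
    × Lb4≤ t s c γ r
    × (∀ (i : ℕ) → suc (suc i) ≤ σ →
         ceiling ((+ s / t) ℚ.* (((+ 2 / suc (suc i)) ℚ.* (⌈ c ÷ γ ⌉ / 1))
                    ℚ.- (+ (s ∸ 1) / (suc (suc i) * suc i)))) ℤ.≤ + r)
theorem1p2 t s c σ γ γ<c r ((_ , feasible) , _) =
    ⌈a÷b⌉≤ (s≤n*σ y₀)
  , ⌈a÷b⌉≤ (c≤n*γ x₀)
  , ceiling-lb3≤ s ⌈ c ÷ γ ⌉ {{m*n≢0 t σ}} ⌈c÷γ⌉≤L (s*L≤n*[t*σ] L-minimal)
  , lb4≤n (<⇒≤ γ<c) x₀ y₀
  -- lb₅ holds for every j ≥ 2.
  , λ i _ → ceiling-lb5≤ s i ⌈ c ÷ γ ⌉ ⌈c÷γ⌉≤L (2psL≤s[s-1]+nt[1+p]p L-minimal (suc i))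
  where
  open FeasibleSchedule feasible
  x₀ = Fin.fromℕ< (ℕ.>-nonZero⁻¹ s)
  y₀ = Fin.fromℕ< (ℕ.>-nonZero⁻¹ c)
  L = supAttendance (proj₁ (minimiser supAttendance x₀))
  L-minimal : ∀ x → L ≤ supAttendance x
  L-minimal = proj₂ (minimiser supAttendance x₀)
  ⌈c÷γ⌉≤L : ⌈ c ÷ γ ⌉ ℤ.≤ + L
  ⌈c÷γ⌉≤L = ⌈a÷b⌉≤ (≤-trans (c≤γ*supAttendance _) (≤-reflexive (*-comm γ L)))
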